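{- For all primes $p\geq 3$ and all integers $d\geq 3$, $\beta_p^d=\alpha_p^d\leq (p-1)(p-2)^{d-2}(p-3)$.
   Context: $\mathbb{Z}_n$ is the ring of integers modulo $n$, identified with $\{0,\dots,n-1\}$; a vector $(v_1,\dots,v_d)\in\mathbb{Z}_n^d$ is zero-sum-free if no non-empty subset of its components sums to $0$ in $\mathbb{Z}_n$; $\alpha_n^d$ is the number of such vectors, and $\beta_n^d$ is the number of zero-sum-free $(x_1,\dots,x_d)\in\mathbb{Z}_n^d$ with $\gcd(x_1,\dots,x_d,n)=1$. -}

module Defs where

open import Data.Nat using (ℕ; zero; suc; _+_)
open import Data.Nat.Divisibility using (_∣_; _∣?_)
open import Data.Nat.GCD using (gcd)
open import Data.Nat.Properties using (_≟_)
open import Data.Fin using (Fin; toℕ)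
open import Data.Fin.Subset using (Subset; Nonempty; _∈_)
open import Data.Fin.Subset.Properties using (anySubset?; nonempty?; _∈?_)
open import Data.Vec using (Vec; []; _∷_; lookup; foldr; map; allFin)
open import Data.List using (List; length; filter; concatMap) renaming ([] to []ˡ; _∷_ to _∷ˡ_; map to mapˡ)
import Data.List as L
open import Data.Bool using (if_then_else_)
open import Data.Product using (∃; _×_; _,_)
open import Relation.Nullary using (¬_; Dec; ¬?; does)
open import Relation.Nullary.Decidable using (_×-dec_)
open import Relation.Binary.PropositionalEquality using (_≡_)

-- Elements of ℤ_n are represented by Fin n = {0,…,n-1}; vectors in ℤ_n^d by Vec (Fin n) d.

subsetSum : ∀ {n d} → Vec (Fin n) d → Subset d → ℕ
subsetSum {d = d} v S =
  foldr (λ _ → ℕ) _+_ 0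
    (map (λ i → if-in i) (allFin d))
  where
  if-in : Fin d → ℕ
  if-in i = if does (i ∈? S) then toℕ (lookup v i) else 0

HasZeroSubsum : ∀ {n d} → Vec (Fin n) d → Set
HasZeroSubsum {n} v = ∃ λ S → Nonempty S × (n ∣ subsetSum v S)

ZeroSumFree : ∀ {n d} → Vec (Fin n) d → Set
ZeroSumFree v = ¬ HasZeroSubsum v

zeroSumFree? : ∀ {n d} (v : Vec (Fin n) d) → Dec (ZeroSumFree v)
zeroSumFree? {n} v = ¬? (anySubset? (λ S → nonempty? S ×-dec (n ∣? subsetSum v S)))

gcdWith : ∀ {n d} → Vec (Fin n) d → ℕ
gcdWith {n} x = foldr (λ _ → ℕ) (λ a b → gcd (toℕ a) b) n x

allVecs : ∀ n d → List (Vec (Fin n) d)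
allVecs n zero = [] ∷ˡ []ˡ
allVecs n (suc d) = concatMap (λ a → mapˡ (a ∷_) (allVecs n d)) (L.allFin n)

α : ℕ → ℕ → ℕ
α n d = length (filter zeroSumFree? (allVecs n d))

β : ℕ → ℕ → ℕ
β n d = length (filter (λ x → zeroSumFree? x ×-dec (gcdWith x ≟ 1)) (allVecs n d))

module Submission where

-- A zero-sum-free vector (x₁, …, x_d) over ℤₙ has no zero entry, no two adjacent entries
-- summing to 0, and x₁ + x₂ + x₃ ≢ 0.  Count the vectors with these weaker properties by
-- choosing the entries from the last one backwards: the last entry avoids 0, an entry a
-- placed in front of b avoids the two distinct residues 0 and −b, and the first entry,
-- placed in front of b and c, avoids the three distinct residues 0, −b and −(b + c).
-- This bounds α by (n − 1)(n − 2)^(d − 2)(n − 3) for every modulus n.  For a prime p,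
-- gcd(x₁, …, x_d, p) divides p and is not p because x₁ ≢ 0, so it is 1 and β = α.

open import Defs
open import Algebra.Properties.CommutativeSemigroup using (interchange; x∙yz≈y∙xz)
open import Data.Bool using (true; false; if_then_else_)
open import Data.Fin as Fin using (Fin; zero; suc; toℕ; fromℕ<)
open import Data.Fin.Properties using (toℕ-fromℕ<)
open import Data.Fin.Subset using (inside; outside; ⊥)
open import Data.List as List using (List; []; _∷_; _++_; length; filter; concatMap; allFin)
open import Data.List.Properties
  using (filter-++; filter-≐; filter-all; filter-none; length-++; length-tabulate; map-cong)
open import Data.List.Membership.Propositional using (_∈_; _∉_)
open import Data.List.Membership.Propositional.Properties using (∈-allFin)
open import Data.List.Relation.Binary.Sublist.Propositional using (⊆-refl)
open import Data.List.Relation.Binary.Sublist.Propositional.Properties using (filter⁺)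
open import Data.List.Relation.Binary.Sublist.Heterogeneous.Properties using (length-mono-≤)
open import Data.List.Relation.Unary.All as All using (All; []; _∷_)
open import Data.List.Relation.Unary.All.Properties using (All¬⇒¬Any)
open import Data.List.Relation.Unary.AllPairs using ([]; _∷_)
open import Data.List.Relation.Unary.Any using (here; there)
open import Data.List.Relation.Unary.Unique.Propositional using (Unique)
open import Data.List.Relation.Unary.Unique.Propositional.Properties using (allFin⁺)
open import Data.Nat as ℕ using (ℕ; zero; suc; pred; _+_; _*_; _∸_; _^_; _≤_; s≤s; NonZero)
open import Data.Nat.DivMod using (_%_; m%n<n; m%n≤n; %-distribˡ-+; m%n%n≡m%n; n%n≡0)
open import Data.Nat.Divisibility using (_∣_; _∣?_; ∣-refl; ∣-trans; ∣m+n∣m⇒∣n; m%n≡0⇒n∣m)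
open import Data.Nat.GCD using (gcd[m,n]∣m; gcd[m,n]∣n)
open import Data.Nat.ListAction using (sum)
open import Data.Nat.Primality using (Prime; prime⇒irreducible; prime⇒nonZero)
open import Data.Nat.Properties
  using (≤-trans; ≤-reflexive; +-mono-≤; *-monoʳ-≤; *-zeroʳ; *-suc; *-comm; +-assoc; +-identityʳ;
         m∸n+n≡m; module ≤-Reasoning; pred[m∸n]≡m∸[1+n]; +-commutativeSemigroup; *-commutativeSemigroup)
open import Data.Product using (_×_; _,_; proj₁)
open import Data.Sum using (inj₁; inj₂)
open import Data.Unit using (tt)
open import Data.Vec as Vec using (Vec; []; _∷_; tabulate; replicate)
open import Data.Vec.Properties using (tabulate-∘; tabulate-allFin)
open import Function using (_∘_)
open import Level using (0ℓ)
open import Relation.Binary.Definitions using (DecidableEquality)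
open import Relation.Binary.PropositionalEquality
  using (_≡_; refl; sym; trans; cong; subst; module ≡-Reasoning)
open import Relation.Nullary using (¬_; ¬?; Dec; yes; no; does; contradiction)
open import Relation.Nullary.Decidable using (_×-dec_)
open import Relation.Unary using (Pred; Decidable; _⊆_; _≐_; ∁; _∩_; U)
open import Relation.Unary.Properties using (∁?; _∩?_; U?)

indicator : {P : Set} → Dec P → ℕ
indicator P? = if does P? then 1 else 0

count : {A : Set} {P : Pred A 0ℓ} → Decidable P → List A → ℕ
count P? xs = length (filter P? xs)

module _ {A : Set} where

  module _ {P : Pred A 0ℓ} (P? : Decidable P) where

    count-∷ : ∀ x xs → count P? (x ∷ xs) ≡ indicator (P? x) + count P? xs
    count-∷ x xs with does (P? x)
    ... | true  = refl
    ... | false = refl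

    count≡sum-indicator : ∀ xs → count P? xs ≡ sum (List.map (indicator ∘ P?) xs)
    count≡sum-indicator []       = refl
    count≡sum-indicator (x ∷ xs) =
      trans (count-∷ x xs) (cong (indicator (P? x) +_) (count≡sum-indicator xs))

    count-++ : ∀ xs ys → count P? (xs ++ ys) ≡ count P? xs + count P? ys
    count-++ xs ys = trans (cong length (filter-++ P? xs ys)) (length-++ (filter P? xs))

    count-concatMap : {B : Set} (f : B → List A) (xs : List B) →
                      count P? (concatMap f xs) ≡ sum (List.map (count P? ∘ f) xs)
    count-concatMap f []       = refl
    count-concatMap f (x ∷ xs) =
      trans (count-++ (f x) (concatMap f xs)) (cong (count P? (f x) +_) (count-concatMap f xs))

    count-map : {B : Set} (f : B → A) (xs : List B) →
                count P? (List.map f xs) ≡ count (λ x → P? (f x)) xs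
    count-map f []       = refl
    count-map f (x ∷ xs) with does (P? (f x))
    ... | true  = cong suc (count-map f xs)
    ... | false = count-map f xs

  module _ {P Q : Pred A 0ℓ} (P? : Decidable P) (Q? : Decidable Q) where

    count-mono : P ⊆ Q → ∀ xs → count P? xs ≤ count Q? xs
    count-mono P⊆Q xs = length-mono-≤ (filter⁺ P? Q? (λ { refl → P⊆Q }) (⊆-refl {x = xs}))

    count-≐ : P ≐ Q → ∀ xs → count P? xs ≡ count Q? xs
    count-≐ P≐Q xs = cong length (filter-≐ P? Q? P≐Q xs)

    count-cong : ∀ {xs} → All (λ x → (P x → Q x) × (Q x → P x)) xs → count P? xs ≡ count Q? xs
    count-cong {[]}     []                  = refl
    count-cong {x ∷ xs} ((P→Q , Q→P) ∷ eqs) with P? x | Q? x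
    ... | yes _  | yes _ = cong suc (count-cong eqs)
    ... | no _   | no _  = count-cong eqs
    ... | yes px | no ¬q = contradiction (P→Q px) ¬q
    ... | no ¬p  | yes q = contradiction (Q→P q) ¬p

sum-map-+ : {B : Set} (f g : B → ℕ) (ys : List B) →
            sum (List.map (λ y → f y + g y) ys) ≡ sum (List.map f ys) + sum (List.map g ys)
sum-map-+ f g []       = refl
sum-map-+ f g (y ∷ ys) =
  trans (cong (f y + g y +_) (sum-map-+ f g ys)) (interchange +-commutativeSemigroup (f y) (g y) _ _)

sum-map-0 : {B : Set} (ys : List B) → sum (List.map (λ _ → 0) ys) ≡ 0
sum-map-0 []       = refl
sum-map-0 (y ∷ ys) = sum-map-0 ys

sum-swap : {A B : Set} (f : A → B → ℕ) (xs : List A) (ys : List B) →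
           sum (List.map (λ x → sum (List.map (f x) ys)) xs) ≡
           sum (List.map (λ y → sum (List.map (λ x → f x y) xs)) ys)
sum-swap f []       ys = sym (sum-map-0 ys)
sum-swap f (x ∷ xs) ys = trans (cong (sum (List.map (f x) ys) +_) (sum-swap f xs ys))
                               (sym (sum-map-+ (f x) (λ y → sum (List.map (λ x → f x y) xs)) ys))

count-swap : {A B : Set} {R : A → B → Set} (R? : ∀ x y → Dec (R x y)) (xs : List A) (ys : List B) →
             sum (List.map (λ x → count (R? x) ys) xs) ≡
             sum (List.map (λ y → count (λ x → R? x y) xs) ys)
count-swap R? xs ys = begin
  sum (List.map (λ x → count (R? x) ys) xs)
    ≡⟨ cong sum (map-cong (λ x → count≡sum-indicator (R? x) ys) xs) ⟩
  sum (List.map (λ x → sum (List.map (λ y → indicator (R? x y)) ys)) xs)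
    ≡⟨ sum-swap (λ x y → indicator (R? x y)) xs ys ⟩
  sum (List.map (λ y → sum (List.map (λ x → indicator (R? x y)) xs)) ys)
    ≡⟨ cong sum (map-cong (λ y → count≡sum-indicator (λ x → R? x y) xs) ys) ⟨
  sum (List.map (λ y → count (λ x → R? x y) xs) ys) ∎
  where open ≡-Reasoning

sum-map-≤-*-count : {B : Set} {Q : Pred B 0ℓ} (Q? : Decidable Q) (f : B → ℕ) {k : ℕ} →
                    (∀ {y} → Q y → f y ≤ k) → (∀ {y} → ¬ Q y → f y ≡ 0) →
                    ∀ ys → sum (List.map f ys) ≤ k * count Q? ys
sum-map-≤-*-count Q? f {k} f≤k f≡0 []       = ≤-reflexive (sym (*-zeroʳ k))
sum-map-≤-*-count Q? f {k} f≤k f≡0 (y ∷ ys) with Q? y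
... | yes qy = ≤-trans (+-mono-≤ (f≤k qy) (sum-map-≤-*-count Q? f f≤k f≡0 ys))
                       (≤-reflexive (sym (*-suc k _)))
... | no ¬qy = ≤-trans (≤-reflexive (cong (_+ sum (List.map f ys)) (f≡0 ¬qy)))
                       (sum-map-≤-*-count Q? f f≤k f≡0 ys)

module _ {A : Set} (_≟_ : DecidableEquality A) where

  open import Data.List.Membership.DecPropositional _≟_ using (_∈?_)

  count-∖ : {P : Pred A 0ℓ} (P? : Decidable P) {c : A} {xs : List A} → Unique xs → c ∈ xs → P c →
            count P? xs ≡ suc (count (P? ∩? ∁? (_≟ c)) xs)
  count-∖ P? {c} (c∉xs ∷ _) (here refl) Pc with P? c | c ≟ c
  ... | no ¬Pc | _       = contradiction Pc ¬Pc
  ... | yes _  | no c≢c  = contradiction refl c≢c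
  ... | yes _  | yes _   =
    cong suc (count-cong P? (P? ∩? ∁? (_≟ c)) (All.map (λ c≢x → (λ Px → Px , c≢x ∘ sym) , proj₁) c∉xs))
  count-∖ P? {c} {x ∷ _} (x∉xs ∷ uxs) (there c∈xs) Pc with P? x | x ≟ c | count-∖ P? uxs c∈xs Pc
  ... | yes _ | yes refl | _  = contradiction c∈xs (All¬⇒¬Any x∉xs)
  ... | yes _ | no _     | eq = cong suc eq
  ... | no _  | _        | eq = eq

  count-∉ : {cs xs : List A} → Unique cs → Unique xs → (∀ {c} → c ∈ cs → c ∈ xs) →
            count (∁? (_∈? cs)) xs ≡ length xs ∸ length cs
  count-∉ {[]}     {xs} [] _ _ = cong length (filter-all (∁? (_∈? [])) (All.universal (λ _ ()) xs))
  count-∉ {c ∷ cs} {xs} (c∉cs ∷ ucs) uxs cs⊆xs = begin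
    count (∁? (_∈? c ∷ cs)) xs
      ≡⟨ count-≐ (∁? (_∈? c ∷ cs)) (∁? (_∈? cs) ∩? ∁? (_≟ c)) ∉-∷ xs ⟩
    count (∁? (_∈? cs) ∩? ∁? (_≟ c)) xs
      ≡⟨ cong pred (count-∖ (∁? (_∈? cs)) uxs (cs⊆xs (here refl)) (All¬⇒¬Any c∉cs)) ⟨
    pred (count (∁? (_∈? cs)) xs)
      ≡⟨ cong pred (count-∉ ucs uxs (cs⊆xs ∘ there)) ⟩
    pred (length xs ∸ length cs)
      ≡⟨ pred[m∸n]≡m∸[1+n] (length xs) (length cs) ⟩
    length xs ∸ suc (length cs) ∎
    where
    open ≡-Reasoning
    ∉-∷ : ∁ (_∈ c ∷ cs) ≐ (∁ (_∈ cs) ∩ ∁ (_≡ c))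
    ∉-∷ = (λ a∉ → a∉ ∘ there , a∉ ∘ here)
        , (λ { (a∉cs , a≢c) (here a≡c) → a≢c a≡c ; (a∉cs , a≢c) (there a∈cs) → a∉cs a∈cs })

module _ {n : ℕ} where

  open import Data.List.Membership.DecPropositional (Fin._≟_ {n}) using (_∈?_)

  count-≤-avoiding : ∀ {P : Pred (Fin n) 0ℓ} (P? : Decidable P) {cs : List (Fin n)} → Unique cs →
                     (∀ {a} → P a → a ∉ cs) → count P? (allFin n) ≤ n ∸ length cs
  count-≤-avoiding P? {cs} ucs avoid = begin
    count P? (allFin n)               ≤⟨ count-mono P? (∁? (_∈? cs)) avoid (allFin n) ⟩
    count (∁? (_∈? cs)) (allFin n)    ≡⟨ count-∉ Fin._≟_ ucs (allFin⁺ n) (λ _ → ∈-allFin _) ⟩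
    length (allFin n) ∸ length cs     ≡⟨ cong (_∸ length cs) (length-tabulate (λ i → i)) ⟩
    n ∸ length cs                     ∎
    where open ≤-Reasoning

  count-allVecs-suc : ∀ {d} {P : Pred (Vec (Fin n) (suc d)) 0ℓ} (P? : Decidable P) →
    count P? (allVecs n (suc d)) ≡
    sum (List.map (λ w → count (λ a → P? (a ∷ w)) (allFin n)) (allVecs n d))
  count-allVecs-suc {d} P? = begin
    count P? (concatMap (λ a → List.map (a ∷_) (allVecs n d)) (allFin n))
      ≡⟨ count-concatMap P? (λ a → List.map (a ∷_) (allVecs n d)) (allFin n) ⟩
    sum (List.map (λ a → count P? (List.map (a ∷_) (allVecs n d))) (allFin n))
      ≡⟨ cong sum (map-cong (λ a → count-map P? (a ∷_) (allVecs n d)) (allFin n)) ⟩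
    sum (List.map (λ a → count (λ w → P? (a ∷ w)) (allVecs n d)) (allFin n))
      ≡⟨ count-swap (λ a w → P? (a ∷ w)) (allFin n) (allVecs n d) ⟩
    sum (List.map (λ w → count (λ a → P? (a ∷ w)) (allFin n)) (allVecs n d)) ∎
    where open ≡-Reasoning

  count-cons-≤ : ∀ {d} {P : Pred (Vec (Fin n) (suc d)) 0ℓ} {Q : Pred (Vec (Fin n) d) 0ℓ}
                 (P? : Decidable P) (Q? : Decidable Q) {k : ℕ} →
                 (∀ {a w} → P (a ∷ w) → Q w) →
                 (∀ {w} → Q w → count (λ a → P? (a ∷ w)) (allFin n) ≤ k) →
                 count P? (allVecs n (suc d)) ≤ k * count Q? (allVecs n d)
  count-cons-≤ {d} {Q = Q} P? Q? P⇒Q fibre≤k =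
    subst (_≤ _) (sym (count-allVecs-suc P?))
      (sum-map-≤-*-count Q? _ fibre≤k fibre≡0 (allVecs n d))
    where
    fibre≡0 : ∀ {w} → ¬ Q w → count (λ a → P? (a ∷ w)) (allFin n) ≡ 0
    fibre≡0 ¬Qw =
      cong length (filter-none (λ a → P? (a ∷ _)) (All.universal (λ _ → ¬Qw ∘ P⇒Q) (allFin n)))

map-tabulate-suc : {A : Set} {d : ℕ} (f : Fin (suc d) → A) →
                   Vec.map f (tabulate suc) ≡ Vec.map (f ∘ suc) (Vec.allFin d)
map-tabulate-suc f = trans (sym (tabulate-∘ f suc)) (tabulate-allFin (f ∘ suc))

module _ {n : ℕ} where

  subsetSum-∷ : ∀ {d} (a : Fin n) (v : Vec (Fin n) d) s S →
                subsetSum (a ∷ v) (s ∷ S) ≡ (if s then toℕ a else 0) + subsetSum v S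
  subsetSum-∷ {d} a v inside  S = cong (λ xs → toℕ a + Vec.sum {n = d} xs) (map-tabulate-suc _)
  subsetSum-∷ {d} a v outside S = cong (Vec.sum {n = d}) (map-tabulate-suc _)

  subsetSum-⊥ : ∀ {d} (v : Vec (Fin n) d) → subsetSum v ⊥ ≡ 0
  subsetSum-⊥ []      = refl
  subsetSum-⊥ (a ∷ v) = trans (subsetSum-∷ a v outside ⊥) (subsetSum-⊥ v)

  subsetSum-prefix : ∀ {k d} (u : Vec (Fin n) k) (v : Vec (Fin n) d) →
                     subsetSum (u Vec.++ v) (replicate k inside Vec.++ ⊥) ≡ Vec.sum (Vec.map toℕ u)
  subsetSum-prefix []      v = subsetSum-⊥ v
  subsetSum-prefix (a ∷ u) v =
    trans (subsetSum-∷ a (u Vec.++ v) inside _) (cong (toℕ a +_) (subsetSum-prefix u v))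

  zeroSumFree-tail : ∀ {d a} {v : Vec (Fin n) d} → ZeroSumFree (a ∷ v) → ZeroSumFree v
  zeroSumFree-tail {a = a} {v} zsf (S , (i , i∈S) , n∣ΣS) =
    zsf (outside ∷ S , (suc i , Vec.there i∈S) , subst (n ∣_) (sym (subsetSum-∷ a v outside S)) n∣ΣS)

  zeroSumFree-prefix : ∀ {k d} (u : Vec (Fin n) (suc k)) {v : Vec (Fin n) d} →
                       ZeroSumFree (u Vec.++ v) → ¬ n ∣ Vec.sum (Vec.map toℕ u)
  zeroSumFree-prefix u {v} zsf n∣Σu =
    zsf (_ , (zero , Vec.here) , subst (n ∣_) (sym (subsetSum-prefix u v)) n∣Σu)

  module _ {d : ℕ} {v : Vec (Fin n) d} where

    zeroSumFree⇒¬∣head : ∀ {a} → ZeroSumFree (a ∷ v) → ¬ n ∣ toℕ a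
    zeroSumFree⇒¬∣head {a} zsf = zeroSumFree-prefix (a ∷ []) zsf ∘ subst (n ∣_) (sym (+-identityʳ _))

    zeroSumFree⇒¬∣pair : ∀ {a b} → ZeroSumFree (a ∷ b ∷ v) → ¬ n ∣ toℕ a + toℕ b
    zeroSumFree⇒¬∣pair {a} {b} zsf =
      zeroSumFree-prefix (a ∷ b ∷ []) zsf ∘ subst (n ∣_) (cong (toℕ a +_) (sym (+-identityʳ _)))

    zeroSumFree⇒¬∣triple : ∀ {a b c} → ZeroSumFree (a ∷ b ∷ c ∷ v) → ¬ n ∣ toℕ a + toℕ b + toℕ c
    zeroSumFree⇒¬∣triple {a} {b} {c} zsf = zeroSumFree-prefix (a ∷ b ∷ c ∷ []) zsf ∘
      subst (n ∣_) (trans (+-assoc (toℕ a) (toℕ b) (toℕ c))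
                          (cong (λ t → toℕ a + (toℕ b + t)) (sym (+-identityʳ _))))

  AdjacentSumFree : ∀ {m} → Vec (Fin n) (suc m) → Set
  AdjacentSumFree (a ∷ [])    = ¬ n ∣ toℕ a
  AdjacentSumFree (a ∷ b ∷ w) = ¬ n ∣ toℕ a × ¬ n ∣ toℕ a + toℕ b × AdjacentSumFree (b ∷ w)

  adjacentSumFree? : ∀ {m} → Decidable (AdjacentSumFree {m})
  adjacentSumFree? (a ∷ [])    = ¬? (n ∣? toℕ a)
  adjacentSumFree? (a ∷ b ∷ w) =
    ¬? (n ∣? toℕ a) ×-dec ¬? (n ∣? toℕ a + toℕ b) ×-dec adjacentSumFree? (b ∷ w)

  adjacentSumFree-head : ∀ {m a} {w : Vec (Fin n) m} → AdjacentSumFree (a ∷ w) → ¬ n ∣ toℕ a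
  adjacentSumFree-head {w = []}    ¬n∣a       = ¬n∣a
  adjacentSumFree-head {w = _ ∷ _} (¬n∣a , _) = ¬n∣a

  adjacentSumFree-tail : ∀ {m a} {w : Vec (Fin n) (suc m)} → AdjacentSumFree (a ∷ w) → AdjacentSumFree w
  adjacentSumFree-tail {w = _ ∷ _} (_ , _ , asf) = asf

  AdjacentSumFree⁺ : ∀ {k} → Vec (Fin n) (3 + k) → Set
  AdjacentSumFree⁺ v@(a ∷ b ∷ c ∷ _) = ¬ n ∣ toℕ a + toℕ b + toℕ c × AdjacentSumFree v

  adjacentSumFree⁺? : ∀ {k} → Decidable (AdjacentSumFree⁺ {k})
  adjacentSumFree⁺? v@(a ∷ b ∷ c ∷ _) = ¬? (n ∣? toℕ a + toℕ b + toℕ c) ×-dec adjacentSumFree? v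

  adjacentSumFree⁺-tail : ∀ {k a} {w : Vec (Fin n) (2 + k)} → AdjacentSumFree⁺ (a ∷ w) → AdjacentSumFree w
  adjacentSumFree⁺-tail {w = _ ∷ _ ∷ _} (_ , asf) = adjacentSumFree-tail asf

  zeroSumFree⇒adjacentSumFree : ∀ {m} {v : Vec (Fin n) (suc m)} → ZeroSumFree v → AdjacentSumFree v
  zeroSumFree⇒adjacentSumFree {v = a ∷ []}    zsf = zeroSumFree⇒¬∣head {v = []} zsf
  zeroSumFree⇒adjacentSumFree {v = a ∷ b ∷ w} zsf =
    zeroSumFree⇒¬∣head {v = b ∷ w} zsf , zeroSumFree⇒¬∣pair {v = w} zsf ,
    zeroSumFree⇒adjacentSumFree (zeroSumFree-tail zsf)

  zeroSumFree⇒adjacentSumFree⁺ : ∀ {k} {v : Vec (Fin n) (3 + k)} → ZeroSumFree v → AdjacentSumFree⁺ v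
  zeroSumFree⇒adjacentSumFree⁺ {v = a ∷ b ∷ c ∷ w} zsf =
    zeroSumFree⇒¬∣triple {v = w} zsf , zeroSumFree⇒adjacentSumFree zsf

module _ {n : ℕ} {{_ : NonZero n}} where

  neg : ℕ → Fin n
  neg x = fromℕ< (m%n<n (n ∸ x % n) n)

  n∣neg[x]+x : ∀ x → n ∣ toℕ (neg x) + x
  n∣neg[x]+x x = m%n≡0⇒n∣m _ n (begin
    (toℕ (neg x) + x) % n           ≡⟨ cong (λ t → (t + x) % n) (toℕ-fromℕ< _) ⟩
    ((n ∸ r) % n + x) % n           ≡⟨ %-distribˡ-+ ((n ∸ r) % n) x n ⟩
    ((n ∸ r) % n % n + r) % n       ≡⟨ cong (λ t → (t + r) % n) (m%n%n≡m%n (n ∸ r) n) ⟩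
    ((n ∸ r) % n + r) % n           ≡⟨ cong (λ t → ((n ∸ r) % n + t) % n) (m%n%n≡m%n x n) ⟨
    ((n ∸ r) % n + r % n) % n       ≡⟨ %-distribˡ-+ (n ∸ r) r n ⟨
    (n ∸ r + r) % n                 ≡⟨ cong (_% n) (m∸n+n≡m (m%n≤n x n)) ⟩
    n % n                           ≡⟨ n%n≡0 n ⟩
    0                               ∎)
    where
    open ≡-Reasoning
    r = x % n

  n∣neg[0] : n ∣ toℕ (neg 0)
  n∣neg[0] = subst (n ∣_) (+-identityʳ _) (n∣neg[x]+x 0)

  neg≡neg[+]⇒∣ : ∀ x y → neg x ≡ neg (x + y) → n ∣ y
  neg≡neg[+]⇒∣ x y eq = ∣m+n∣m⇒∣n n∣neg[x]+x+y (n∣neg[x]+x x)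
    where
    n∣neg[x]+x+y : n ∣ toℕ (neg x) + x + y
    n∣neg[x]+x+y = subst (λ c → n ∣ toℕ c + x + y) (sym eq)
                     (subst (n ∣_) (sym (+-assoc _ x y)) (n∣neg[x]+x (x + y)))

  count-adjacentSumFree : ∀ m → count adjacentSumFree? (allVecs n (suc m)) ≤ (n ∸ 1) * (n ∸ 2) ^ m
  count-adjacentSumFree zero = count-cons-≤ {n} adjacentSumFree? U? (λ _ → tt) fibre
    where
    fibre : ∀ {w : Vec (Fin n) 0} → U w → count (λ a → adjacentSumFree? (a ∷ w)) (allFin n) ≤ n ∸ 1
    fibre {[]} _ = count-≤-avoiding {n} _ ([] ∷ []) λ { ¬n∣a (here refl) → ¬n∣a n∣neg[0] }
  count-adjacentSumFree (suc m) = begin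
    count adjacentSumFree? (allVecs n (2 + m))
      ≤⟨ count-cons-≤ {n} adjacentSumFree? adjacentSumFree? adjacentSumFree-tail fibre ⟩
    (n ∸ 2) * count adjacentSumFree? (allVecs n (suc m))
      ≤⟨ *-monoʳ-≤ (n ∸ 2) (count-adjacentSumFree m) ⟩
    (n ∸ 2) * ((n ∸ 1) * (n ∸ 2) ^ m)
      ≡⟨ x∙yz≈y∙xz *-commutativeSemigroup (n ∸ 2) (n ∸ 1) _ ⟩
    (n ∸ 1) * (n ∸ 2) ^ suc m ∎
    where
    open ≤-Reasoning
    fibre : ∀ {w : Vec (Fin n) (suc m)} → AdjacentSumFree w →
            count (λ a → adjacentSumFree? (a ∷ w)) (allFin n) ≤ n ∸ 2
    fibre {b ∷ _} asf = count-≤-avoiding {n} _ distinct avoid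
      where
      distinct : Unique (neg 0 ∷ neg (toℕ b) ∷ [])
      distinct = (adjacentSumFree-head asf ∘ neg≡neg[+]⇒∣ 0 (toℕ b) ∷ []) ∷ [] ∷ []
      avoid : ∀ {a} → AdjacentSumFree (a ∷ b ∷ _) → a ∉ neg 0 ∷ neg (toℕ b) ∷ []
      avoid (¬n∣a , _)       (here refl)         = ¬n∣a n∣neg[0]
      avoid (_ , ¬n∣a+b , _) (there (here refl)) = ¬n∣a+b (n∣neg[x]+x (toℕ b))

  count-adjacentSumFree⁺ : ∀ k →
    count adjacentSumFree⁺? (allVecs n (3 + k)) ≤ (n ∸ 1) * (n ∸ 2) ^ suc k * (n ∸ 3)
  count-adjacentSumFree⁺ k = begin
    count adjacentSumFree⁺? (allVecs n (3 + k))
      ≤⟨ count-cons-≤ {n} adjacentSumFree⁺? adjacentSumFree? adjacentSumFree⁺-tail fibre ⟩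
    (n ∸ 3) * count adjacentSumFree? (allVecs n (2 + k))
      ≤⟨ *-monoʳ-≤ (n ∸ 3) (count-adjacentSumFree (suc k)) ⟩
    (n ∸ 3) * ((n ∸ 1) * (n ∸ 2) ^ suc k)
      ≡⟨ *-comm (n ∸ 3) _ ⟩
    (n ∸ 1) * (n ∸ 2) ^ suc k * (n ∸ 3) ∎
    where
    open ≤-Reasoning
    fibre : ∀ {w : Vec (Fin n) (2 + k)} → AdjacentSumFree w →
            count (λ a → adjacentSumFree⁺? (a ∷ w)) (allFin n) ≤ n ∸ 3
    fibre {b ∷ c ∷ _} (¬n∣b , ¬n∣b+c , asf) = count-≤-avoiding {n} _ distinct avoid
      where
      distinct : Unique (neg 0 ∷ neg (toℕ b) ∷ neg (toℕ b + toℕ c) ∷ [])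
      distinct = (¬n∣b ∘ neg≡neg[+]⇒∣ 0 (toℕ b) ∷ ¬n∣b+c ∘ neg≡neg[+]⇒∣ 0 (toℕ b + toℕ c) ∷ [])
               ∷ (adjacentSumFree-head asf ∘ neg≡neg[+]⇒∣ (toℕ b) (toℕ c) ∷ [])
               ∷ [] ∷ []
      avoid : ∀ {a} → AdjacentSumFree⁺ (a ∷ b ∷ c ∷ _) →
              a ∉ neg 0 ∷ neg (toℕ b) ∷ neg (toℕ b + toℕ c) ∷ []
      avoid (_ , ¬n∣a , _)       (here refl)                 = ¬n∣a n∣neg[0]
      avoid (_ , _ , ¬n∣a+b , _) (there (here refl))         = ¬n∣a+b (n∣neg[x]+x (toℕ b))
      avoid (¬n∣a+b+c , _)       (there (there (here refl))) =
        ¬n∣a+b+c (subst (n ∣_) (sym (+-assoc _ (toℕ b) (toℕ c))) (n∣neg[x]+x (toℕ b + toℕ c)))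

  α-bound : ∀ k → α n (3 + k) ≤ (n ∸ 1) * (n ∸ 2) ^ suc k * (n ∸ 3)
  α-bound k =
    ≤-trans (count-mono zeroSumFree? adjacentSumFree⁺? zeroSumFree⇒adjacentSumFree⁺ (allVecs n (3 + k)))
            (count-adjacentSumFree⁺ k)

gcdWith∣n : ∀ {n d} (x : Vec (Fin n) d) → gcdWith x ∣ n
gcdWith∣n []      = ∣-refl
gcdWith∣n (a ∷ x) = ∣-trans (gcd[m,n]∣n (toℕ a) (gcdWith x)) (gcdWith∣n x)

module _ {p : ℕ} (p-prime : Prime p) where

  zeroSumFree⇒gcdWith≡1 : ∀ {d} {x : Vec (Fin p) (suc d)} → ZeroSumFree x → gcdWith x ≡ 1
  zeroSumFree⇒gcdWith≡1 {x = a ∷ x} zsf with prime⇒irreducible p-prime (gcdWith∣n (a ∷ x))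
  ... | inj₁ g≡1 = g≡1
  ... | inj₂ g≡p =
    contradiction (subst (_∣ toℕ a) g≡p (gcd[m,n]∣m (toℕ a) (gcdWith x))) (zeroSumFree⇒¬∣head {v = x} zsf)

  β≡α : ∀ d → β p (suc d) ≡ α p (suc d)
  β≡α d = count-≐ (λ x → zeroSumFree? x ×-dec (gcdWith x ℕ.≟ 1)) zeroSumFree?
                  (proj₁ , λ {x} zsf → zsf , zeroSumFree⇒gcdWith≡1 {x = x} zsf) (allVecs p (suc d))

-- The bound needs only 0 < p.
proposition5p2 : (p d : ℕ) → Prime p → 3 ≤ p → 3 ≤ d →
    (β p d ≡ α p d) × (α p d ≤ (p ∸ 1) * (p ∸ 2) ^ (d ∸ 2) * (p ∸ 3))
proposition5p2 p (suc (suc (suc k))) p-prime _ (s≤s (s≤s (s≤s _))) = β≡α p-prime (2 + k) , α-bound k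
  where instance _ = prime⇒nonZero p-prime
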